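{- Let $F$ be an $(n,m)$-function of algebraic degree $k$. Then $|N_{\mathcal{A},k}(F)|=2^{n-k}|N_k(F)|$. In particular, $F$ is $k$th-order sum-free if and only if $|N_k(F)|=|\mathcal{U}_{n,k}|$, i.e. every $k$-dimensional linear subspace of $\mathbb{F}_2^n$ is nonvanishing for $F$.
   Context: An $(n,m)$-function is a map $F\colon\mathbb{F}_2^n\to\mathbb{F}_2^m$; its algebraic degree is the maximal degree of the ANFs of its coordinate functions. $\mathcal{U}_{n,k}$ is the set of $k$-dimensional linear subspaces of $\mathbb{F}_2^n$; a $k$-flat is a set $U+a$ with $U\in\mathcal{U}_{n,k}$, $a\in\mathbb{F}_2^n$. $N_k(F)=\{U\in\mathcal{U}_{n,k}:\sum_{x\in U}F(x)\neq 0\}$ and $N_{\mathcal{A},k}(F)$ is the set of $k$-flats $A$ with $\sum_{x\in A}F(x)\neq0$. A $k$-flat $A$ is vanishing if $\sum_{x\in A}F(x)=0$; $F$ is $k$th-order sum-free if it has no vanishing $k$-flats. -}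

module Defs where

open import Data.Bool using (Bool; true; false; not; _∧_; _∨_; _xor_; if_then_else_)
import Data.Bool.Properties as BoolP
open import Data.Nat using (ℕ; zero; suc; _+_; _^_; _≤_)
open import Data.Fin using (Fin)
open import Data.Vec using (Vec; []; _∷_; lookup; replicate; zipWith)
import Data.Vec.Properties as VecP
open import Data.List using (List; []; _∷_; [_]; map; _++_; filter; length; foldr; concatMap)
open import Data.List.Relation.Unary.All using (All; all?)
open import Data.List.Relation.Unary.Any using (Any; any?)
open import Data.Product using (_×_; Σ; ∃; _,_)
open import Relation.Nullary using (¬_; Dec; yes; no; ¬?)
open import Relation.Nullary.Decidable using (⌊_⌋; _×-dec_)
open import Relation.Binary.PropositionalEquality using (_≡_)
open import Data.Empty using (⊥)

-- The vector space 𝔽₂ⁿ, with Bool as 𝔽₂ (xor = addition)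

V : ℕ → Set
V n = Vec Bool n

_⊕_ : ∀ {n} → V n → V n → V n
_⊕_ = zipWith _xor_

𝟘 : ∀ {n} → V n
𝟘 = replicate _ false

_≟V_ : ∀ {n} (x y : V n) → Dec (x ≡ y)
_≟V_ = VecP.≡-dec BoolP._≟_

allVecs : (n : ℕ) → List (V n)
allVecs zero = [ [] ]
allVecs (suc n) = map (false ∷_) (allVecs n) ++ map (true ∷_) (allVecs n)

Sub : ℕ → Set
Sub n = V n → Bool

-- Enumeration of all subsets of 𝔽₂ⁿ: every characteristic function
-- occurs exactly once up to pointwise equality on 𝔽₂ⁿ.
private
  upd : ∀ {n} → V n → Bool → Sub n → Sub n
  upd x b f y = if ⌊ y ≟V x ⌋ then b else f y

  subsOf : ∀ {n} → List (V n) → List (Sub n)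
  subsOf [] = [ (λ _ → false) ]
  subsOf (x ∷ xs) = concatMap (λ f → upd x false f ∷ upd x true f ∷ []) (subsOf xs)

allSubsets : (n : ℕ) → List (Sub n)
allSubsets n = subsOf (allVecs n)

members : ∀ {n} → Sub n → List (V n)
members {n} S = filter (λ x → S x BoolP.≟ true) (allVecs n)

card : ∀ {n} → Sub n → ℕ
card S = length (members S)

vsum : ∀ {m} → List (V m) → V m
vsum = foldr _⊕_ 𝟘

sumOver : ∀ {n m} → (V n → V m) → Sub n → V m
sumOver F A = vsum (map F (members A))

IsSubspace : ∀ {n} → ℕ → Sub n → Set
IsSubspace {n} k U =
  U 𝟘 ≡ true
  × All (λ x → All (λ y → U x ≡ true → U y ≡ true → U (x ⊕ y) ≡ true) (allVecs n)) (allVecs n)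
  × card U ≡ 2 ^ k

-- A is a k-flat: A = U + a for some k-dim subspace U and a ∈ 𝔽₂ⁿ
-- (membership x ∈ U + a  ⇔  x + a ∈ U).
IsFlat : ∀ {n} → ℕ → Sub n → Set
IsFlat {n} k A =
  Any (λ a → Any (λ U → IsSubspace k U × All (λ x → A x ≡ U (x ⊕ a)) (allVecs n))
                 (allSubsets n))
      (allVecs n)

Vanishing : ∀ {n m} → (V n → V m) → Sub n → Set
Vanishing F A = sumOver F A ≡ 𝟘

isSubspace? : ∀ {n} k (U : Sub n) → Dec (IsSubspace k U)
isSubspace? {n} k U =
  (U 𝟘 BoolP.≟ true)
  ×-dec (all? (λ x → all? (λ y → imp (U x) (U y) (U (x ⊕ y))) (allVecs n)) (allVecs n)
  ×-dec (card U Data.Nat.≟ 2 ^ k))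
  where
  imp : (a b c : Bool) → Dec (a ≡ true → b ≡ true → c ≡ true)
  imp _ _ true = yes (λ _ _ → _≡_.refl)
  imp false _ false = yes (λ ())
  imp true false false = yes (λ _ ())
  imp true true false = no (λ f → case (f _≡_.refl _≡_.refl))
    where
    case : false ≡ true → ⊥
    case ()

isFlat? : ∀ {n} k (A : Sub n) → Dec (IsFlat k A)
isFlat? {n} k A =
  any? (λ a → any? (λ U → isSubspace? k U
                          ×-dec all? (λ x → A x BoolP.≟ U (x ⊕ a)) (allVecs n))
                   (allSubsets n))
       (allVecs n)

vanishing? : ∀ {n m} (F : V n → V m) (A : Sub n) → Dec (Vanishing F A)
vanishing? F A = sumOver F A ≟V 𝟘

numSubspaces : (n k : ℕ) → ℕ
numSubspaces n k = length (filter (isSubspace? k) (allSubsets n))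

numNk : ∀ {n m} → (V n → V m) → ℕ → ℕ
numNk {n} F k = length (filter (λ U → isSubspace? k U ×-dec ¬? (vanishing? F U)) (allSubsets n))

numNAk : ∀ {n m} → (V n → V m) → ℕ → ℕ
numNAk {n} F k = length (filter (λ A → isFlat? k A ×-dec ¬? (vanishing? F A)) (allSubsets n))

SumFree : ∀ {n m} → (V n → V m) → ℕ → Set
SumFree {n} F k = (A : Sub n) → IsFlat k A → ¬ Vanishing F A

_≼ᵇ_ : ∀ {n} → V n → V n → Bool
[] ≼ᵇ [] = true
(a ∷ x) ≼ᵇ (b ∷ u) = (not a ∨ b) ∧ (x ≼ᵇ u)

wt : ∀ {n} → V n → ℕ
wt [] = 0
wt (true ∷ x) = suc (wt x)
wt (false ∷ x) = wt x

-- ANF coefficient of f at monomial xᵘ: a_u = Σ_{x ≼ u} f(x)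
-- (so f(x) = Σ_u a_u xᵘ, the unique ANF).
anfCoeff : ∀ {n} → (V n → Bool) → V n → Bool
anfCoeff {n} f u = foldr _xor_ false (map f (filter (λ x → (x ≼ᵇ u) BoolP.≟ true) (allVecs n)))

HasDegree : ∀ {n m} → (V n → V m) → ℕ → Set
HasDegree {n} {m} F k =
  ((i : Fin m) (u : V n) → anfCoeff (λ x → lookup (F x) i) u ≡ true → wt u ≤ k)
  × Σ (Fin m) (λ i → Σ (V n) (λ u → anfCoeff (λ x → lookup (F x) i) u ≡ true × wt u ≡ k))

module Submission where

-- Write a_u for the ANF coefficients of a coordinate F_i, so that Σ_{x∈A} F_i(x) = Σ_u a_u Σ_{x∈A} x^u.
-- When deg F ≤ k it therefore suffices that, for wt u ≤ k = dim U, the monomial sum over U+a does not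
-- depend on a. If a ∉ U, pick w ≠ 0 in the subspace U ∪ (U+a) with support disjoint from that of u.
-- Translation by w preserves x^u: if w ∈ U it permutes U and U+a without fixed points, so both sums
-- vanish, and if w ∈ U+a it maps U+a onto U. Such a w exists, for otherwise projection onto the
-- coordinates of u would be injective on U ∪ (U+a), which has 2^(k+1) > 2^(wt u) elements.
-- Hence every k-flat U+a has the F-sum of U, and counting the triples (A, U, a) with U ∈ N_k(F) and
-- A = U+a in two ways gives 2^k |N_{A,k}(F)| = 2^n |N_k(F)|. As subspaces are flats and
-- N_k(F) ⊆ U_{n,k}, F is sum-free iff |N_k(F)| = |U_{n,k}|.

open import Defs
open import Level using (0ℓ)
open import Function using (_∘_)
open import Function.Bundles using (_⇔_; mk⇔; Equivalence)
open import Function.Construct.Composition using (_⇔-∘_)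
open import Function.Construct.Identity using (⇔-id)
open import Data.Product.Function.NonDependent.Propositional using (_×-⇔_)
open import Algebra.Core using (Op₂)
open import Algebra.Structures using (IsCommutativeSemiring)
open import Algebra.Bundles using (CommutativeSemiring; CommutativeRing; CommutativeMonoid)
open import Data.Bool using (Bool; true; false; not; _∧_; _∨_; _xor_; if_then_else_)
import Data.Bool.Properties as BoolP
open import Data.Bool.Properties using (⇔→≡)
open import Algebra.Properties.CommutativeSemigroup
  (CommutativeMonoid.commutativeSemigroup BoolP.∧-commutativeMonoid) using (x∙yz≈z∙xy)
open import Data.Nat using (ℕ; zero; suc; _+_; _*_; _^_; _≤_; _<_; _∸_; z≤n; s≤s)
import Data.Nat.Properties as ℕP
open import Data.Fin using (Fin)
open import Data.Vec using ([]; _∷_; lookup; tabulate; zipWith)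
open import Data.Vec.Properties
  using (∷-injectiveʳ; lookup-replicate; lookup-zipWith; tabulate∘lookup; tabulate-cong)
open import Data.Vec.Relation.Binary.Pointwise.Inductive using (Pointwise-≡⇒≡; zipWith-comm; zipWith-assoc)
open import Data.List using (List; []; _∷_; map; _++_; foldr; filter; length; concatMap)
open import Data.List.Membership.Propositional using (_∈_; find; lose)
open import Data.List.Membership.Propositional.Properties using (∈-map⁺; ∈-map⁻; ∈-++⁺ˡ; ∈-++⁺ʳ)
open import Data.List.Relation.Unary.All using (All; []; _∷_; all?)
import Data.List.Relation.Unary.All as All
open import Data.List.Relation.Unary.Any using (here; there; any?)
import Data.List.Relation.Unary.Any as Any
open import Data.List.Relation.Unary.AllPairs using ([]; _∷_)
open import Data.List.Relation.Unary.Unique.Propositional using (Unique)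
import Data.List.Relation.Unary.Unique.Propositional.Properties as Unique
open import Data.List.Relation.Binary.Disjoint.Propositional using (Disjoint)
open import Data.Product using (_×_; ∃; _,_; proj₁; proj₂)
open import Data.Empty using (⊥-elim)
open import Relation.Nullary using (¬_; Dec; yes; no; does; ¬?)
open import Relation.Nullary.Decidable using (_×-dec_; ⌊_⌋)
import Relation.Nullary.Decidable as Dec
open import Relation.Binary.PropositionalEquality
  using (_≡_; _≢_; refl; sym; trans; cong; cong₂; subst; module ≡-Reasoning)

⊕-comm : ∀ {n} (x y : V n) → x ⊕ y ≡ y ⊕ x
⊕-comm x y = Pointwise-≡⇒≡ (zipWith-comm BoolP.xor-comm x y)

⊕-assoc : ∀ {n} (x y z : V n) → (x ⊕ y) ⊕ z ≡ x ⊕ (y ⊕ z)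
⊕-assoc x y z = Pointwise-≡⇒≡ (zipWith-assoc BoolP.xor-assoc x y z)

⊕-identityʳ : ∀ {n} (x : V n) → x ⊕ 𝟘 ≡ x
⊕-identityʳ [] = refl
⊕-identityʳ (b ∷ x) = cong₂ _∷_ (BoolP.xor-identityʳ b) (⊕-identityʳ x)

⊕-self : ∀ {n} (x : V n) → x ⊕ x ≡ 𝟘
⊕-self [] = refl
⊕-self (b ∷ x) = cong₂ _∷_ (BoolP.xor-same b) (⊕-self x)

⊕-cancelʳ : ∀ {n} (x y : V n) → (x ⊕ y) ⊕ y ≡ x
⊕-cancelʳ x y = trans (⊕-assoc x y y) (trans (cong (x ⊕_) (⊕-self y)) (⊕-identityʳ x))

⊕-identityˡ : ∀ {n} (x : V n) → 𝟘 ⊕ x ≡ x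
⊕-identityˡ x = trans (⊕-comm 𝟘 x) (⊕-identityʳ x)

⊕-swapʳ : ∀ {n} (x y z : V n) → (x ⊕ y) ⊕ z ≡ (x ⊕ z) ⊕ y
⊕-swapʳ x y z = trans (⊕-assoc x y z) (trans (cong (x ⊕_) (⊕-comm y z)) (sym (⊕-assoc x z y)))

⊕-cancel-common : ∀ {n} (x y z : V n) → (x ⊕ z) ⊕ (y ⊕ z) ≡ x ⊕ y
⊕-cancel-common x y z =
  trans (sym (⊕-assoc (x ⊕ z) y z)) (trans (cong (_⊕ z) (⊕-swapʳ x z y)) (⊕-cancelʳ (x ⊕ y) z))

⊕≡𝟘⇒≡ : ∀ {n} {x y : V n} → x ⊕ y ≡ 𝟘 → x ≡ y
⊕≡𝟘⇒≡ {x = x} {y} x⊕y≡𝟘 = trans (sym (⊕-cancelʳ x y)) (trans (cong (_⊕ y) x⊕y≡𝟘) (⊕-identityˡ y))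

_∩_ : ∀ {n} → V n → V n → V n
_∩_ = zipWith _∧_

∩-distribʳ-⊕ : ∀ {n} (x y u : V n) → (x ⊕ y) ∩ u ≡ (x ∩ u) ⊕ (y ∩ u)
∩-distribʳ-⊕ []      []      []      = refl
∩-distribʳ-⊕ (a ∷ x) (b ∷ y) (c ∷ u) = cong₂ _∷_ (BoolP.∧-distribʳ-xor c a b) (∩-distribʳ-⊕ x y u)

≼ᵇ-⊕-disjoint : ∀ {n} (u w : V n) → w ∩ u ≡ 𝟘 → ∀ x → (u ≼ᵇ (x ⊕ w)) ≡ (u ≼ᵇ x)
≼ᵇ-⊕-disjoint []      []          _    []      = refl
≼ᵇ-⊕-disjoint (c ∷ u) (false ∷ w) w∩u≡𝟘 (b ∷ x) =
  cong₂ (λ b′ r → (not c ∨ b′) ∧ r) (BoolP.xor-identityʳ b)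
        (≼ᵇ-⊕-disjoint u w (∷-injectiveʳ w∩u≡𝟘) x)
≼ᵇ-⊕-disjoint (false ∷ u) (true ∷ w) w∩u≡𝟘 (b ∷ x) = ≼ᵇ-⊕-disjoint u w (∷-injectiveʳ w∩u≡𝟘) x
≼ᵇ-⊕-disjoint (true ∷ u) (true ∷ w) () x

wt≤n : ∀ {n} (u : V n) → wt u ≤ n
wt≤n []          = z≤n
wt≤n (true ∷ u)  = s≤s (wt≤n u)
wt≤n (false ∷ u) = ℕP.m≤n⇒m≤1+n (wt≤n u)

∈-allVecs : ∀ {n} (x : V n) → x ∈ allVecs n
∈-allVecs []          = here refl
∈-allVecs (false ∷ x) = ∈-++⁺ˡ (∈-map⁺ (false ∷_) (∈-allVecs x))
∈-allVecs (true ∷ x)  = ∈-++⁺ʳ (map (false ∷_) (allVecs _)) (∈-map⁺ (true ∷_) (∈-allVecs x))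

allVecs-unique : ∀ n → Unique (allVecs n)
allVecs-unique zero    = [] ∷ []
allVecs-unique (suc n) = Unique.++⁺ (Unique.map⁺ ∷-injectiveʳ (allVecs-unique n))
                                    (Unique.map⁺ ∷-injectiveʳ (allVecs-unique n))
                                    heads-differ
  where
  heads-differ : Disjoint (map (false ∷_) (allVecs n)) (map (true ∷_) (allVecs n))
  heads-differ (v∈₀ , v∈₁) with ∈-map⁻ (false ∷_) v∈₀ | ∈-map⁻ (true ∷_) v∈₁
  ... | _ , _ , refl | _ , _ , ()

All-allVecs⇔ : ∀ {n} {P : V n → Set} → All P (allVecs n) ⇔ (∀ x → P x)
All-allVecs⇔ = mk⇔ (λ all x → All.lookup all (∈-allVecs x)) (λ f → All.tabulate (λ {x} _ → f x))

module Sums {R : Set} {_+_ _*_ : Op₂ R} {0# 1# : R}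
            (isCommutativeSemiring : IsCommutativeSemiring _≡_ _+_ _*_ 0# 1#) where

  open IsCommutativeSemiring isCommutativeSemiring
    using (+-assoc; +-comm; +-identityˡ; zeroʳ; distribˡ)
  private
    commutativeSemiring : CommutativeSemiring 0ℓ 0ℓ
    commutativeSemiring = record { isCommutativeSemiring = isCommutativeSemiring }

  open import Algebra.Properties.CommutativeSemigroup
    (CommutativeSemiring.+-commutativeSemigroup commutativeSemiring) using (interchange)

  private variable A B : Set

  ∑ₗ : List A → (A → R) → R
  ∑ₗ xs f = foldr _+_ 0# (map f xs)

  ∑ : (n : ℕ) → (V n → R) → R
  ∑ n = ∑ₗ (allVecs n)

  ∑ₗ-cong : ∀ (xs : List A) {f g : A → R} → (∀ x → f x ≡ g x) → ∑ₗ xs f ≡ ∑ₗ xs g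
  ∑ₗ-cong []       f≗g = refl
  ∑ₗ-cong (x ∷ xs) f≗g = cong₂ _+_ (f≗g x) (∑ₗ-cong xs f≗g)

  ∑ₗ-++ : ∀ (xs ys : List A) f → ∑ₗ (xs ++ ys) f ≡ ∑ₗ xs f + ∑ₗ ys f
  ∑ₗ-++ []       ys f = sym (+-identityˡ (∑ₗ ys f))
  ∑ₗ-++ (x ∷ xs) ys f = trans (cong (f x +_) (∑ₗ-++ xs ys f)) (sym (+-assoc _ _ _))

  ∑ₗ-0 : ∀ (xs : List A) → ∑ₗ xs (λ _ → 0#) ≡ 0#
  ∑ₗ-0 []       = refl
  ∑ₗ-0 (x ∷ xs) = trans (cong (0# +_) (∑ₗ-0 xs)) (+-identityˡ 0#)

  ∑ₗ-+ : ∀ (xs : List A) f g → ∑ₗ xs (λ x → f x + g x) ≡ ∑ₗ xs f + ∑ₗ xs g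
  ∑ₗ-+ []       f g = sym (+-identityˡ 0#)
  ∑ₗ-+ (x ∷ xs) f g = trans (cong ((f x + g x) +_) (∑ₗ-+ xs f g)) (interchange _ _ _ _)

  *-∑ₗ : ∀ (xs : List A) c f → ∑ₗ xs (λ x → c * f x) ≡ c * ∑ₗ xs f
  *-∑ₗ []       c f = sym (zeroʳ c)
  *-∑ₗ (x ∷ xs) c f = trans (cong ((c * f x) +_) (*-∑ₗ xs c f)) (sym (distribˡ c _ _))

  ∑ₗ-swap : ∀ (xs : List A) (ys : List B) (h : A → B → R) →
            ∑ₗ xs (λ x → ∑ₗ ys (h x)) ≡ ∑ₗ ys (λ y → ∑ₗ xs (λ x → h x y))
  ∑ₗ-swap []       ys h = sym (∑ₗ-0 ys)
  ∑ₗ-swap (x ∷ xs) ys h =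
    trans (cong (∑ₗ ys (h x) +_) (∑ₗ-swap xs ys h)) (sym (∑ₗ-+ ys (h x) _))

  ∑ₗ-map : ∀ (g : A → B) (xs : List A) f → ∑ₗ (map g xs) f ≡ ∑ₗ xs (λ x → f (g x))
  ∑ₗ-map g []       f = refl
  ∑ₗ-map g (x ∷ xs) f = cong (f (g x) +_) (∑ₗ-map g xs f)

  ∑ₗ-filter : ∀ {P : A → Set} (P? : ∀ x → Dec (P x)) xs f →
              ∑ₗ (filter P? xs) f ≡ ∑ₗ xs (λ x → if does (P? x) then f x else 0#)
  ∑ₗ-filter P? []       f = refl
  ∑ₗ-filter P? (x ∷ xs) f with does (P? x)
  ... | true  = cong (f x +_) (∑ₗ-filter P? xs f)
  ... | false = trans (∑ₗ-filter P? xs f) (sym (+-identityˡ _))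

  ∑ₗ-concatMap : ∀ (g : A → List B) xs f → ∑ₗ (concatMap g xs) f ≡ ∑ₗ xs (λ x → ∑ₗ (g x) f)
  ∑ₗ-concatMap g []       f = refl
  ∑ₗ-concatMap g (x ∷ xs) f =
    trans (∑ₗ-++ (g x) (concatMap g xs) f) (cong (∑ₗ (g x) f +_) (∑ₗ-concatMap g xs f))

  ∑-suc : ∀ n (f : V (suc n) → R) →
          ∑ (suc n) f ≡ ∑ n (λ x → f (false ∷ x)) + ∑ n (λ x → f (true ∷ x))
  ∑-suc n f = begin
    ∑ₗ (map (false ∷_) (allVecs n) ++ map (true ∷_) (allVecs n)) f
      ≡⟨ ∑ₗ-++ (map (false ∷_) (allVecs n)) _ f ⟩
    ∑ₗ (map (false ∷_) (allVecs n)) f + ∑ₗ (map (true ∷_) (allVecs n)) f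
      ≡⟨ cong₂ _+_ (∑ₗ-map (false ∷_) (allVecs n) f) (∑ₗ-map (true ∷_) (allVecs n) f) ⟩
    ∑ n (λ x → f (false ∷ x)) + ∑ n (λ x → f (true ∷ x)) ∎
    where open ≡-Reasoning

  ∑-translate : ∀ n (f : V n → R) (w : V n) → ∑ n (λ x → f (x ⊕ w)) ≡ ∑ n f
  ∑-translate zero    f []        = refl
  ∑-translate (suc n) f (b ∷ w) = begin
    ∑ (suc n) (λ x → f (x ⊕ (b ∷ w)))
      ≡⟨ ∑-suc n _ ⟩
    ∑ n (λ x → f (b ∷ (x ⊕ w))) + ∑ n (λ x → f (not b ∷ (x ⊕ w)))
      ≡⟨ cong₂ _+_ (∑-translate n _ w) (∑-translate n _ w) ⟩
    ∑ n (λ x → f (b ∷ x)) + ∑ n (λ x → f (not b ∷ x))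
      ≡⟨ halves b ⟩
    ∑ n (λ x → f (false ∷ x)) + ∑ n (λ x → f (true ∷ x))
      ≡⟨ ∑-suc n f ⟨
    ∑ (suc n) f ∎
    where
    open ≡-Reasoning
    halves : ∀ b → ∑ n (λ x → f (b ∷ x)) + ∑ n (λ x → f (not b ∷ x))
                 ≡ ∑ n (λ x → f (false ∷ x)) + ∑ n (λ x → f (true ∷ x))
    halves false = refl
    halves true  = +-comm _ _

module Parity = Sums (CommutativeRing.isCommutativeSemiring BoolP.xor-∧-commutativeRing)
module Count  = Sums ℕP.+-*-isCommutativeSemiring

∑-periodic≡false : ∀ n (g : V n → Bool) (w : V n) → w ≢ 𝟘 →
                   (∀ x → g (x ⊕ w) ≡ g x) → Parity.∑ n g ≡ false
∑-periodic≡false zero    g []        w≢𝟘 _ = ⊥-elim (w≢𝟘 refl)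
∑-periodic≡false (suc n) g (false ∷ w) w≢𝟘 periodic = begin
  Parity.∑ (suc n) g
    ≡⟨ Parity.∑-suc n g ⟩
  Parity.∑ n (λ x → g (false ∷ x)) xor Parity.∑ n (λ x → g (true ∷ x))
    ≡⟨ cong₂ _xor_ (∑-periodic≡false n _ w (w≢𝟘 ∘ cong (false ∷_)) (periodic ∘ (false ∷_)))
                   (∑-periodic≡false n _ w (w≢𝟘 ∘ cong (false ∷_)) (periodic ∘ (true ∷_))) ⟩
  false ∎
  where open ≡-Reasoning
∑-periodic≡false (suc n) g (true ∷ w) _ periodic = begin
  Parity.∑ (suc n) g
    ≡⟨ Parity.∑-suc n g ⟩
  s₀ xor Parity.∑ n (λ x → g (true ∷ x))
    ≡⟨ cong (s₀ xor_) (Parity.∑-translate n (λ x → g (true ∷ x)) w) ⟨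
  s₀ xor Parity.∑ n (λ x → g (true ∷ (x ⊕ w)))
    ≡⟨ cong (s₀ xor_) (Parity.∑ₗ-cong (allVecs n) (periodic ∘ (false ∷_))) ⟩
  s₀ xor s₀
    ≡⟨ BoolP.xor-same s₀ ⟩
  false ∎
  where
  open ≡-Reasoning
  s₀ = Parity.∑ n (λ x → g (false ∷ x))

∑-const : ∀ n c → Count.∑ n (λ _ → c) ≡ 2 ^ n * c
∑-const zero    c = refl
∑-const (suc n) c = begin
  Count.∑ (suc n) (λ _ → c)                  ≡⟨ Count.∑-suc n (λ _ → c) ⟩
  Count.∑ n (λ _ → c) + Count.∑ n (λ _ → c)  ≡⟨ cong₂ _+_ (∑-const n c) (∑-const n c) ⟩
  2 ^ n * c + 2 ^ n * c                      ≡⟨ cong (2 ^ n * c +_) (ℕP.+-identityʳ (2 ^ n * c)) ⟨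
  2 * (2 ^ n * c)                            ≡⟨ ℕP.*-assoc 2 (2 ^ n) c ⟨
  2 ^ suc n * c ∎
  where open ≡-Reasoning

does-≟-true : ∀ b → does (b BoolP.≟ true) ≡ b
does-≟-true true  = refl
does-≟-true false = refl

toℕ : Bool → ℕ
toℕ b = if b then 1 else 0

toℕ≤1 : ∀ b → toℕ b ≤ 1
toℕ≤1 true  = s≤s z≤n
toℕ≤1 false = z≤n

toℕ-injective : ∀ {b c} → toℕ b ≡ toℕ c → b ≡ c
toℕ-injective {true}  {true}  _ = refl
toℕ-injective {false} {false} _ = refl

length≡∑₁ : ∀ {A : Set} (xs : List A) → length xs ≡ Count.∑ₗ xs (λ _ → 1)
length≡∑₁ []       = refl
length≡∑₁ (x ∷ xs) = cong suc (length≡∑₁ xs)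

length-filter : ∀ {A : Set} {P : A → Set} (P? : ∀ x → Dec (P x)) xs →
                length (filter P? xs) ≡ Count.∑ₗ xs (λ x → toℕ (does (P? x)))
length-filter P? xs = trans (length≡∑₁ (filter P? xs)) (Count.∑ₗ-filter P? xs (λ _ → 1))

count≡suc⇒any : ∀ {A : Set} (p : A → Bool) xs {c} → Count.∑ₗ xs (λ x → toℕ (p x)) ≡ suc c →
                ∃ λ x → x ∈ xs × p x ≡ true
count≡suc⇒any p (x ∷ xs) count≡suc with p x in px
... | true  = x , here refl , px
... | false = let y , y∈ , py = count≡suc⇒any p xs count≡suc in y , there y∈ , py

∑ₗ-mono-≤ : ∀ {A : Set} (xs : List A) {f g : A → ℕ} →
            (∀ x → f x ≤ g x) → Count.∑ₗ xs f ≤ Count.∑ₗ xs g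
∑ₗ-mono-≤ []       f≤g = z≤n
∑ₗ-mono-≤ (x ∷ xs) f≤g = ℕP.+-mono-≤ (f≤g x) (∑ₗ-mono-≤ xs f≤g)

+-mono-≤-equality : ∀ {a b c d} → a ≤ b → c ≤ d → a + c ≡ b + d → a ≡ b × c ≡ d
+-mono-≤-equality {a} {b} {c} {d} a≤b c≤d a+c≡b+d =
  a≡b , ℕP.+-cancelˡ-≡ a c d (trans a+c≡b+d (cong (_+ d) (sym a≡b)))
  where
  b+c≤a+c : b + c ≤ a + c
  b+c≤a+c = ℕP.≤-trans (ℕP.+-monoʳ-≤ b c≤d) (ℕP.≤-reflexive (sym a+c≡b+d))
  a≡b : a ≡ b
  a≡b = ℕP.≤-antisym a≤b (ℕP.+-cancelʳ-≤ c b a b+c≤a+c)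

∑ₗ-mono-≤-equality : ∀ {A : Set} (xs : List A) {f g : A → ℕ} → (∀ x → f x ≤ g x) →
                     Count.∑ₗ xs f ≡ Count.∑ₗ xs g → ∀ {x} → x ∈ xs → f x ≡ g x
∑ₗ-mono-≤-equality (y ∷ ys) f≤g sums≡ (here refl) =
  proj₁ (+-mono-≤-equality (f≤g y) (∑ₗ-mono-≤ ys f≤g) sums≡)
∑ₗ-mono-≤-equality (y ∷ ys) f≤g sums≡ (there x∈) =
  ∑ₗ-mono-≤-equality ys f≤g (proj₂ (+-mono-≤-equality (f≤g y) (∑ₗ-mono-≤ ys f≤g) sums≡)) x∈

does≡true⇔ : ∀ {P : Set} (d : Dec P) → does d ≡ true ⇔ P
does≡true⇔ (yes p) = mk⇔ (λ _ → p) (λ _ → refl)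
does≡true⇔ (no ¬p) = mk⇔ (λ ()) (⊥-elim ∘ ¬p)

size : ∀ {n} → Sub n → ℕ
size {n} A = Count.∑ n (λ x → toℕ (A x))

sumOn : ∀ {n} → Sub n → (V n → Bool) → Bool
sumOn {n} A f = Parity.∑ n (λ x → A x ∧ f x)

_∪_ : ∀ {n} → Sub n → Sub n → Sub n
(A ∪ B) x = A x ∨ B x

translate : ∀ {n} → Sub n → V n → Sub n
translate A a x = A (x ⊕ a)

Closed : ∀ {n} → Sub n → Set
Closed U = ∀ x y → U x ≡ true → U y ≡ true → U (x ⊕ y) ≡ true

card≡size : ∀ {n} (A : Sub n) → card A ≡ size A
card≡size {n} A = trans (length-filter (λ x → A x BoolP.≟ true) (allVecs n))
                         (Count.∑ₗ-cong (allVecs n) (cong toℕ ∘ does-≟-true ∘ A))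

∑ₗ-members : ∀ {n} (A : Sub n) (f : V n → Bool) → Parity.∑ₗ (members A) f ≡ sumOn A f
∑ₗ-members {n} A f =
  trans (Parity.∑ₗ-filter (λ x → A x BoolP.≟ true) (allVecs n) f)
        (Parity.∑ₗ-cong (allVecs n) if-member)
  where
  if-member : ∀ x → (if does (A x BoolP.≟ true) then f x else false) ≡ A x ∧ f x
  if-member x with A x
  ... | true  = refl
  ... | false = refl

sumOn-cong : ∀ {n} {A B : Sub n} {f g : V n → Bool} →
             (∀ x → A x ≡ B x) → (∀ x → f x ≡ g x) → sumOn A f ≡ sumOn B g
sumOn-cong {n} A≗B f≗g = Parity.∑ₗ-cong (allVecs n) (λ x → cong₂ _∧_ (A≗B x) (f≗g x))

sumOn-translate : ∀ {n} (A : Sub n) (f : V n → Bool) w →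
                  sumOn (translate A w) f ≡ sumOn A (λ x → f (x ⊕ w))
sumOn-translate {n} A f w = begin
  Parity.∑ n (λ x → A (x ⊕ w) ∧ f x)
    ≡⟨ Parity.∑ₗ-cong (allVecs n) (λ x → cong (λ y → A (x ⊕ w) ∧ f y) (⊕-cancelʳ x w)) ⟨
  Parity.∑ n (λ x → A (x ⊕ w) ∧ f ((x ⊕ w) ⊕ w))
    ≡⟨ Parity.∑-translate n (λ x → A x ∧ f (x ⊕ w)) w ⟩
  sumOn A (λ x → f (x ⊕ w)) ∎
  where open ≡-Reasoning

size-translate : ∀ {n} (A : Sub n) a → size (translate A a) ≡ size A
size-translate {n} A = Count.∑-translate n (λ x → toℕ (A x))

size-∪ : ∀ {n} (A B : Sub n) → (∀ x → A x ∧ B x ≡ false) → size (A ∪ B) ≡ size A + size B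
size-∪ {n} A B disjoint =
  trans (Count.∑ₗ-cong (allVecs n) (λ x → toℕ-∨ (A x) (B x) (disjoint x)))
        (Count.∑ₗ-+ (allVecs n) _ _)
  where
  toℕ-∨ : ∀ a b → a ∧ b ≡ false → toℕ (a ∨ b) ≡ toℕ a + toℕ b
  toℕ-∨ true  false _ = refl
  toℕ-∨ false b     _ = refl

lookup-vsum : ∀ {m} (vs : List (V m)) (i : Fin m) → lookup (vsum vs) i ≡ Parity.∑ₗ vs (λ v → lookup v i)
lookup-vsum []       i = lookup-replicate i false
lookup-vsum (v ∷ vs) i =
  trans (lookup-zipWith _xor_ i v (vsum vs)) (cong (lookup v i xor_) (lookup-vsum vs i))

lookup-sumOver : ∀ {n m} (F : V n → V m) (A : Sub n) (i : Fin m) →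
                 lookup (sumOver F A) i ≡ sumOn A (λ x → lookup (F x) i)
lookup-sumOver F A i = begin
  lookup (vsum (map F (members A))) i
    ≡⟨ lookup-vsum (map F (members A)) i ⟩
  Parity.∑ₗ (map F (members A)) (λ v → lookup v i)
    ≡⟨ Parity.∑ₗ-map F (members A) _ ⟩
  Parity.∑ₗ (members A) (λ x → lookup (F x) i)
    ≡⟨ ∑ₗ-members A _ ⟩
  sumOn A (λ x → lookup (F x) i) ∎
  where open ≡-Reasoning

sumOver-ext : ∀ {n m} (F : V n → V m) {A B : Sub n} →
               (∀ i → sumOn A (λ x → lookup (F x) i) ≡ sumOn B (λ x → lookup (F x) i)) →
               sumOver F A ≡ sumOver F B
sumOver-ext F {A} {B} coordinatewise = begin
  sumOver F A                            ≡⟨ tabulate∘lookup _ ⟨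
  tabulate (lookup (sumOver F A))        ≡⟨ tabulate-cong lookups ⟩
  tabulate (lookup (sumOver F B))        ≡⟨ tabulate∘lookup _ ⟩
  sumOver F B ∎
  where
  open ≡-Reasoning
  lookups : ∀ i → lookup (sumOver F A) i ≡ lookup (sumOver F B) i
  lookups i = trans (lookup-sumOver F A i) (trans (coordinatewise i) (sym (lookup-sumOver F B i)))

sumOver-≗ : ∀ {n m} (F : V n → V m) {A B : Sub n} → (∀ x → A x ≡ B x) → sumOver F A ≡ sumOver F B
sumOver-≗ F A≗B = sumOver-ext F (λ i → sumOn-cong A≗B (λ _ → refl))

möbius : ∀ {n} → (V n → Bool) → V n → Bool
möbius f u = sumOn (_≼ᵇ u) f

anfCoeff≡möbius : ∀ {n} (f : V n → Bool) u → anfCoeff f u ≡ möbius f u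
anfCoeff≡möbius f u = ∑ₗ-members (_≼ᵇ u) f

module _ {n : ℕ} where

  möbius-cong : ∀ {f g : V n → Bool} → (∀ x → f x ≡ g x) → ∀ u → möbius f u ≡ möbius g u
  möbius-cong f≗g u = Parity.∑ₗ-cong (allVecs n) (λ x → cong ((x ≼ᵇ u) ∧_) (f≗g x))

  möbius-xor : ∀ (f g : V n → Bool) u → möbius (λ x → f x xor g x) u ≡ möbius f u xor möbius g u
  möbius-xor f g u =
    trans (Parity.∑ₗ-cong (allVecs n) (λ x → BoolP.∧-distribˡ-xor (x ≼ᵇ u) (f x) (g x)))
          (Parity.∑ₗ-+ (allVecs n) _ _)

  möbius-false∷ : ∀ (f : V (suc n) → Bool) u → möbius f (false ∷ u) ≡ möbius (λ x → f (false ∷ x)) u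
  möbius-false∷ f u = begin
    möbius f (false ∷ u)
      ≡⟨ Parity.∑-suc n _ ⟩
    möbius (λ x → f (false ∷ x)) u xor Parity.∑ n (λ _ → false)
      ≡⟨ cong (möbius (λ x → f (false ∷ x)) u xor_) (Parity.∑ₗ-0 (allVecs n)) ⟩
    möbius (λ x → f (false ∷ x)) u xor false
      ≡⟨ BoolP.xor-identityʳ _ ⟩
    möbius (λ x → f (false ∷ x)) u ∎
    where open ≡-Reasoning

  möbius-true∷ : ∀ (f : V (suc n) → Bool) u →
                 möbius f (true ∷ u) ≡
                 möbius (λ x → f (false ∷ x)) u xor möbius (λ x → f (true ∷ x)) u
  möbius-true∷ f u = Parity.∑-suc n _

möbius-involutive : ∀ n (f : V n → Bool) u → möbius (möbius f) u ≡ f u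
möbius-involutive zero    f []        = trans (BoolP.xor-identityʳ _) (BoolP.xor-identityʳ (f []))
möbius-involutive (suc n) f (false ∷ u) = begin
  möbius (möbius f) (false ∷ u)               ≡⟨ möbius-false∷ (möbius f) u ⟩
  möbius (λ x → möbius f (false ∷ x)) u       ≡⟨ möbius-cong (möbius-false∷ f) u ⟩
  möbius (möbius (λ x → f (false ∷ x))) u     ≡⟨ möbius-involutive n _ u ⟩
  f (false ∷ u) ∎
  where open ≡-Reasoning
möbius-involutive (suc n) f (true ∷ u) = begin
  möbius (möbius f) (true ∷ u)
    ≡⟨ möbius-true∷ (möbius f) u ⟩
  möbius (λ x → möbius f (false ∷ x)) u xor möbius (λ x → möbius f (true ∷ x)) u
    ≡⟨ cong₂ _xor_ (möbius-cong (möbius-false∷ f) u) (möbius-cong (möbius-true∷ f) u) ⟩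
  möbius (möbius f₀) u xor möbius (λ x → möbius f₀ x xor möbius f₁ x) u
    ≡⟨ cong (möbius (möbius f₀) u xor_) (möbius-xor (möbius f₀) (möbius f₁) u) ⟩
  möbius (möbius f₀) u xor (möbius (möbius f₀) u xor möbius (möbius f₁) u)
    ≡⟨ cong₂ (λ a b → a xor (a xor b)) (möbius-involutive n f₀ u) (möbius-involutive n f₁ u) ⟩
  f₀ u xor (f₀ u xor f₁ u)
    ≡⟨ BoolP.xor-assoc (f₀ u) (f₀ u) (f₁ u) ⟨
  (f₀ u xor f₀ u) xor f₁ u
    ≡⟨ cong (_xor f₁ u) (BoolP.xor-same (f₀ u)) ⟩
  f₁ u ∎
  where
  open ≡-Reasoning
  f₀ f₁ : V n → Bool
  f₀ x = f (false ∷ x)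
  f₁ x = f (true ∷ x)

sumOn-anf : ∀ {n} (A : Sub n) (f : V n → Bool) →
            sumOn A f ≡ Parity.∑ n (λ u → möbius f u ∧ sumOn A (u ≼ᵇ_))
sumOn-anf {n} A f = begin
  Parity.∑ n (λ x → A x ∧ f x)
    ≡⟨ Parity.∑ₗ-cong (allVecs n) (λ x → cong (A x ∧_) (möbius-involutive n f x)) ⟨
  Parity.∑ n (λ x → A x ∧ Parity.∑ n (λ u → (u ≼ᵇ x) ∧ a u))
    ≡⟨ Parity.∑ₗ-cong (allVecs n) (λ x → Parity.*-∑ₗ (allVecs n) (A x) _) ⟨
  Parity.∑ n (λ x → Parity.∑ n (λ u → A x ∧ ((u ≼ᵇ x) ∧ a u)))
    ≡⟨ Parity.∑ₗ-swap (allVecs n) (allVecs n) _ ⟩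
  Parity.∑ n (λ u → Parity.∑ n (λ x → A x ∧ ((u ≼ᵇ x) ∧ a u)))
    ≡⟨ Parity.∑ₗ-cong (allVecs n) (λ u →
         Parity.∑ₗ-cong (allVecs n) (λ x → x∙yz≈z∙xy (A x) (u ≼ᵇ x) (a u))) ⟩
  Parity.∑ n (λ u → Parity.∑ n (λ x → a u ∧ (A x ∧ (u ≼ᵇ x))))
    ≡⟨ Parity.∑ₗ-cong (allVecs n) (λ u → Parity.*-∑ₗ (allVecs n) (a u) _) ⟩
  Parity.∑ n (λ u → a u ∧ sumOn A (u ≼ᵇ_)) ∎
  where
  open ≡-Reasoning
  a : V n → Bool
  a = möbius f

sumOn-≡-by-monomials : ∀ {n} (A B : Sub n) (f : V n → Bool) →
                       (∀ u → möbius f u ≡ true → sumOn A (u ≼ᵇ_) ≡ sumOn B (u ≼ᵇ_)) →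
                       sumOn A f ≡ sumOn B f
sumOn-≡-by-monomials {n} A B f monomials-agree =
  trans (sumOn-anf A f) (trans (Parity.∑ₗ-cong (allVecs n) agree) (sym (sumOn-anf B f)))
  where
  agree : ∀ u → möbius f u ∧ sumOn A (u ≼ᵇ_) ≡ möbius f u ∧ sumOn B (u ≼ᵇ_)
  agree u with möbius f u in aᵤ
  ... | true  = monomials-agree u aᵤ
  ... | false = refl

ProjectionInjective : ∀ {n} → V n → Sub n → Set
ProjectionInjective u W = ∀ x y → W x ≡ true → W y ≡ true → x ∩ u ≡ y ∩ u → x ≡ y

size≤2^wt : ∀ n (W : Sub n) u → ProjectionInjective u W → size W ≤ 2 ^ wt u
size≤2^wt zero W [] _ = ℕP.≤-trans (ℕP.≤-reflexive (ℕP.+-identityʳ _)) (toℕ≤1 (W []))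
size≤2^wt (suc n) W (true ∷ u) injective = begin
  size W                                  ≡⟨ Count.∑-suc n _ ⟩
  size W₀ + size W₁                       ≤⟨ ℕP.+-mono-≤ (size≤2^wt n W₀ u injective₀)
                                                          (size≤2^wt n W₁ u injective₁) ⟩
  2 ^ wt u + 2 ^ wt u                     ≡⟨ cong (2 ^ wt u +_) (ℕP.+-identityʳ (2 ^ wt u)) ⟨
  2 ^ wt (true ∷ u) ∎
  where
  open ℕP.≤-Reasoning
  W₀ W₁ : Sub n
  W₀ x = W (false ∷ x)
  W₁ x = W (true ∷ x)
  injective₀ : ProjectionInjective u W₀
  injective₀ x y x∈ y∈ eq = ∷-injectiveʳ (injective _ _ x∈ y∈ (cong (false ∷_) eq))
  injective₁ : ProjectionInjective u W₁
  injective₁ x y x∈ y∈ eq = ∷-injectiveʳ (injective _ _ x∈ y∈ (cong (true ∷_) eq))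
size≤2^wt (suc n) W (false ∷ u) injective = begin
  size W                                  ≡⟨ Count.∑-suc n _ ⟩
  size W₀ + size W₁                       ≡⟨ size-∪ W₀ W₁ disjoint ⟨
  size (W₀ ∪ W₁)                          ≤⟨ size≤2^wt n (W₀ ∪ W₁) u injective₀₁ ⟩
  2 ^ wt u ∎
  where
  open ℕP.≤-Reasoning
  W₀ W₁ : Sub n
  W₀ x = W (false ∷ x)
  W₁ x = W (true ∷ x)
  disjoint : ∀ x → W₀ x ∧ W₁ x ≡ false
  disjoint x with W₀ x in x∈₀ | W₁ x in x∈₁
  ... | true  | true  with () ← injective _ _ x∈₀ x∈₁ refl
  ... | true  | false = refl
  ... | false | _     = refl
  lift : ∀ x → (W₀ ∪ W₁) x ≡ true → ∃ λ b → W (b ∷ x) ≡ true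
  lift x x∈ with W₀ x in x∈₀
  ... | true  = false , x∈₀
  ... | false = true , x∈
  injective₀₁ : ProjectionInjective u (W₀ ∪ W₁)
  injective₀₁ x y x∈ y∈ eq with lift x x∈ | lift y y∈
  ... | b , bx∈ | c , cy∈ =
    ∷-injectiveʳ (injective _ _ bx∈ cy∈
                   (cong₂ _∷_ (trans (BoolP.∧-zeroʳ b) (sym (BoolP.∧-zeroʳ c))) eq))

closed-without-disjoint⇒injective : ∀ {n} {W : Sub n} {u : V n} → Closed W →
  (∀ w → W w ≡ true → w ∩ u ≡ 𝟘 → w ≡ 𝟘) → ProjectionInjective u W
closed-without-disjoint⇒injective {u = u} closed only-𝟘 x y x∈ y∈ x∩u≡y∩u =
  ⊕≡𝟘⇒≡ (only-𝟘 (x ⊕ y) (closed x y x∈ y∈)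
           (trans (∩-distribʳ-⊕ x y u) (trans (cong (_⊕ (y ∩ u)) x∩u≡y∩u) (⊕-self (y ∩ u)))))

record Subspace {n} (k : ℕ) (U : Sub n) : Set where
  field
    𝟘∈         : U 𝟘 ≡ true
    ⊕-closed   : Closed U
    size≡2^k   : size U ≡ 2 ^ k

translate-member : ∀ {n} {U : Sub n} → Closed U → ∀ {c} → U c ≡ true → ∀ x → translate U c x ≡ U x
translate-member {U = U} closed {c} c∈U x =
  ⇔→≡ (mk⇔ (λ x⊕c∈U → subst (λ y → U y ≡ true) (⊕-cancelʳ x c) (closed _ _ x⊕c∈U c∈U))
           (λ x∈U → closed _ _ x∈U c∈U))

sumOn-monomial-periodic : ∀ {n} (A : Sub n) (u w : V n) → w ≢ 𝟘 → w ∩ u ≡ 𝟘 →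
                          (∀ x → A (x ⊕ w) ≡ A x) → sumOn A (u ≼ᵇ_) ≡ false
sumOn-monomial-periodic {n} A u w w≢𝟘 w∩u≡𝟘 periodic =
  ∑-periodic≡false n _ w w≢𝟘 (λ x → cong₂ _∧_ (periodic x) (≼ᵇ-⊕-disjoint u w w∩u≡𝟘 x))

module _ {n k : ℕ} {U : Sub n} (subspace : Subspace k U) where
  open Subspace subspace

  translate-periodic : ∀ {w} → U w ≡ true → ∀ a x → translate U a (x ⊕ w) ≡ translate U a x
  translate-periodic {w} w∈U a x =
    trans (cong U (⊕-swapʳ x w a)) (translate-member ⊕-closed w∈U (x ⊕ a))

  member-shift : ∀ {c z z′} → U c ≡ true → z ≡ z′ ⊕ c → U z ≡ U z′
  member-shift {z′ = z′} c∈U refl = translate-member ⊕-closed c∈U z′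

  span : V n → Sub n
  span a = U ∪ translate U a

  span-⊕ : ∀ {a x} → span a x ≡ true → ∀ y → span a (x ⊕ y) ≡ span a y
  span-⊕ {a} {x} x∈span y with U x in x∈U
  ... | true  = cong₂ _∨_ (member-shift x∈U (⊕-comm x y))
                          (member-shift x∈U (trans (cong (_⊕ a) (⊕-comm x y)) (⊕-swapʳ y x a)))
  ... | false = trans (cong₂ _∨_ x⊕y∈U x⊕y⊕a∈U) (BoolP.∨-comm (U (y ⊕ a)) (U y))
    where
    -- U x ≡ false in this clause, so x∈span : U (x ⊕ a) ≡ true.
    x⊕y∈U : U (x ⊕ y) ≡ U (y ⊕ a)
    x⊕y∈U = member-shift x∈span (trans (⊕-comm x y) (sym (⊕-cancel-common y x a)))
    x⊕y⊕a∈U : U ((x ⊕ y) ⊕ a) ≡ U y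
    x⊕y⊕a∈U = member-shift x∈span (trans (cong (_⊕ a) (⊕-comm x y)) (⊕-assoc y x a))

  span-closed : ∀ a → Closed (span a)
  span-closed a x y x∈ y∈ = trans (span-⊕ x∈ y) y∈

  span-size : ∀ {a} → U a ≡ false → size (span a) ≡ 2 ^ k + 2 ^ k
  span-size {a} a∉U =
    trans (size-∪ U (translate U a) disjoint)
          (cong₂ _+_ size≡2^k (trans (size-translate U a) size≡2^k))
    where
    disjoint : ∀ x → U x ∧ U (x ⊕ a) ≡ false
    disjoint x with U x in x∈U
    ... | true  = trans (member-shift x∈U (⊕-comm x a)) a∉U
    ... | false = refl

  disjoint-direction : ∀ {u a} → wt u ≤ k → U a ≡ false →
                       ∃ λ w → span a w ≡ true × w ≢ 𝟘 × w ∩ u ≡ 𝟘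
  disjoint-direction {u} {a} wt≤k a∉U
    with any? (λ w → (span a w BoolP.≟ true) ×-dec ¬? (w ≟V 𝟘) ×-dec ((w ∩ u) ≟V 𝟘)) (allVecs n)
  ... | yes found = let w , _ , w-ok = find found in w , w-ok
  ... | no none   = ⊥-elim (ℕP.<⇒≱ 2^k<2^k+2^k (begin
        2 ^ k + 2 ^ k     ≡⟨ span-size a∉U ⟨
        size (span a)     ≤⟨ size≤2^wt n (span a) u
                               (closed-without-disjoint⇒injective (span-closed a) only-𝟘) ⟩
        2 ^ wt u          ≤⟨ ℕP.^-monoʳ-≤ 2 wt≤k ⟩
        2 ^ k ∎))
    where
    open ℕP.≤-Reasoning
    2^k<2^k+2^k : 2 ^ k < 2 ^ k + 2 ^ k
    2^k<2^k+2^k = ℕP.m<m+n (2 ^ k) (ℕP.m^n>0 2 k)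
    only-𝟘 : ∀ w → span a w ≡ true → w ∩ u ≡ 𝟘 → w ≡ 𝟘
    only-𝟘 w w∈ w∩u≡𝟘 with w ≟V 𝟘
    ... | yes w≡𝟘 = w≡𝟘
    ... | no  w≢𝟘 = ⊥-elim (none (lose (∈-allVecs w) (w∈ , w≢𝟘 , w∩u≡𝟘)))

  sumOn-translate-monomial : ∀ {u} → wt u ≤ k → ∀ a →
                             sumOn (translate U a) (u ≼ᵇ_) ≡ sumOn U (u ≼ᵇ_)
  sumOn-translate-monomial {u} wt≤k a with U a in a∈U
  ... | true  = sumOn-cong (translate-member ⊕-closed a∈U) (λ _ → refl)
  ... | false with disjoint-direction wt≤k a∈U
  ... | w , w∈span , w≢𝟘 , w∩u≡𝟘 with U w in w∈U
  ...   | true  =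
    trans (sumOn-monomial-periodic (translate U a) u w w≢𝟘 w∩u≡𝟘 (translate-periodic w∈U a))
          (sym (sumOn-monomial-periodic U u w w≢𝟘 w∩u≡𝟘 (translate-member ⊕-closed w∈U)))
  ...   | false = begin
    sumOn (translate U a) (u ≼ᵇ_)               ≡⟨ sumOn-cong (λ _ → refl) (≼ᵇ-⊕-disjoint u w w∩u≡𝟘) ⟨
    sumOn (translate U a) (λ x → u ≼ᵇ (x ⊕ w))  ≡⟨ sumOn-translate (translate U a) _ w ⟨
    sumOn (translate (translate U a) w) (u ≼ᵇ_) ≡⟨ sumOn-cong U+a+w≗U (λ _ → refl) ⟩
    sumOn U (u ≼ᵇ_) ∎
    where
    open ≡-Reasoning
    -- U w ≡ false in this clause, so w∈span : U (w ⊕ a) ≡ true.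
    U+a+w≗U : ∀ x → translate (translate U a) w x ≡ U x
    U+a+w≗U x = member-shift w∈span (⊕-assoc x w a)

DegreeAtMost : ∀ {n m} → (V n → V m) → ℕ → Set
DegreeAtMost {n} {m} F k = (i : Fin m) (u : V n) → anfCoeff (λ x → lookup (F x) i) u ≡ true → wt u ≤ k

sumOver-translate : ∀ {n m k} (F : V n → V m) → DegreeAtMost F k →
                    ∀ {U} → Subspace k U → ∀ a → sumOver F (translate U a) ≡ sumOver F U
sumOver-translate F deg subspace a = sumOver-ext F λ i →
  sumOn-≡-by-monomials _ _ _ λ u aᵤ →
    sumOn-translate-monomial subspace {u} (deg i u (trans (anfCoeff≡möbius _ u) aᵤ)) a

mutual
  -- Defs keeps the recursion behind allSubsets private. Unification in the clause below solves
  -- this metavariable to that function, so its defining equations then hold definitionally.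
  enumerateSubsets : ∀ {n} → List (V n) → List (Sub n)
  enumerateSubsets = _

  allSubsets≡enumerate : ∀ n → allSubsets n ≡ enumerateSubsets (allVecs n)
  allSubsets≡enumerate n with allVecs n
  ... | vs = refl

module _ {n : ℕ} where

  agreeOn : List (V n) → Sub n → Sub n → Bool
  agreeOn xs g f = does (all? (λ x → g x BoolP.≟ f x) xs)

  count-agreeing : ∀ xs → Unique xs → ∀ f →
                   Count.∑ₗ (enumerateSubsets xs) (λ g → toℕ (agreeOn xs g f)) ≡ 1
  count-agreeing []       _                 f = refl
  count-agreeing (x ∷ xs) (x∉xs ∷ xs-unique) f =
    trans (Count.∑ₗ-concatMap _ (enumerateSubsets xs) _)
          (trans (Count.∑ₗ-cong (enumerateSubsets xs) one-extension-agrees) (count-agreeing xs xs-unique f))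
    where
    -- Defs' private `upd x`, to which it is definitionally equal.
    update : Bool → Sub n → Sub n
    update b g y = if ⌊ y ≟V x ⌋ then b else g y
    update-here : ∀ b g → update b g x ≡ b
    update-here b g with x ≟V x
    ... | yes _   = refl
    ... | no  x≢x = ⊥-elim (x≢x refl)
    update-elsewhere : ∀ {ys} → All (x ≢_) ys → ∀ b g → agreeOn ys (update b g) f ≡ agreeOn ys g f
    update-elsewhere []                 b g = refl
    update-elsewhere {y ∷ _} (x≢y ∷ x∉) b g
      with y ≟V x
    ... | yes y≡x = ⊥-elim (x≢y (sym y≡x))
    ... | no  _   = cong (does (g y BoolP.≟ f y) ∧_) (update-elsewhere x∉ b g)
    one-extension-agrees : ∀ g → toℕ (agreeOn (x ∷ xs) (update false g) f)
                                   + (toℕ (agreeOn (x ∷ xs) (update true g) f) + 0)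
                                 ≡ toℕ (agreeOn xs g f)
    one-extension-agrees g
      rewrite update-here false g | update-here true g
            | update-elsewhere x∉xs false g | update-elsewhere x∉xs true g
      with f x | agreeOn xs g f
    ... | false | false = refl
    ... | false | true  = refl
    ... | true  | false = refl
    ... | true  | true  = refl

  _≟ₛ_ : (A B : Sub n) → Dec (∀ x → A x ≡ B x)
  A ≟ₛ B = Dec.map All-allVecs⇔ (all? (λ x → A x BoolP.≟ B x) (allVecs n))

  allSubsets-unique : ∀ f → Count.∑ₗ (allSubsets n) (λ g → toℕ (does (g ≟ₛ f))) ≡ 1
  allSubsets-unique f rewrite allSubsets≡enumerate n = count-agreeing (allVecs n) (allVecs-unique n) f

  allSubsets-complete : ∀ f → ∃ λ g → g ∈ allSubsets n × (∀ x → g x ≡ f x)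
  allSubsets-complete f =
    let g , g∈ , g≟f = count≡suc⇒any (λ g → does (g ≟ₛ f)) (allSubsets n) (allSubsets-unique f)
    in g , g∈ , Equivalence.to (does≡true⇔ (g ≟ₛ f)) g≟f

module _ {n : ℕ} (k : ℕ) where

  IsSubspace⇔Subspace : ∀ {U : Sub n} → IsSubspace k U ⇔ Subspace k U
  IsSubspace⇔Subspace {U} = mk⇔
    (λ (𝟘∈ , closed , card≡) → record
      { 𝟘∈       = 𝟘∈
      ; ⊕-closed = λ x y → Equivalence.to All-allVecs⇔ (Equivalence.to All-allVecs⇔ closed x) y
      ; size≡2^k = trans (sym (card≡size U)) card≡ })
    (λ subspace → let open Subspace subspace in
      𝟘∈ , Equivalence.from All-allVecs⇔ (λ x → Equivalence.from All-allVecs⇔ (⊕-closed x)) ,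
      trans (card≡size U) size≡2^k)

  Subspace-cong : ∀ {U U′ : Sub n} → (∀ x → U x ≡ U′ x) → Subspace k U → Subspace k U′
  Subspace-cong {U} {U′} U≗U′ subspace = record
    { 𝟘∈       = trans (sym (U≗U′ 𝟘)) 𝟘∈
    ; ⊕-closed = λ x y x∈ y∈ →
        trans (sym (U≗U′ (x ⊕ y))) (⊕-closed x y (trans (U≗U′ x) x∈) (trans (U≗U′ y) y∈))
    ; size≡2^k = trans (Count.∑ₗ-cong (allVecs n) (λ x → cong toℕ (sym (U≗U′ x)))) size≡2^k }
    where open Subspace subspace

  Flat : Sub n → Set
  Flat A = ∃ λ a → ∃ λ U → Subspace k U × (∀ x → A x ≡ translate U a x)

  Subspace⇒Flat : ∀ {U : Sub n} → Subspace k U → Flat U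
  Subspace⇒Flat {U} subspace = 𝟘 , U , subspace , λ x → cong U (sym (⊕-identityʳ x))

  IsFlat⇔Flat : ∀ {A : Sub n} → IsFlat k A ⇔ Flat A
  IsFlat⇔Flat {A} = mk⇔ to from
    where
    to : IsFlat k A → Flat A
    to isFlat =
      let a , U-found = Any.satisfied isFlat
          U , isSubspace , A≗U+a = Any.satisfied U-found
      in a , U , Equivalence.to IsSubspace⇔Subspace isSubspace , Equivalence.to All-allVecs⇔ A≗U+a
    from : Flat A → IsFlat k A
    from (a , U , subspace , A≗U+a) =
      let U′ , U′∈ , U′≗U = allSubsets-complete U
      in lose (∈-allVecs a) (lose U′∈
           ( Equivalence.from IsSubspace⇔Subspace (Subspace-cong (sym ∘ U′≗U) subspace)
           , Equivalence.from All-allVecs⇔ (λ x → trans (A≗U+a x) (sym (U′≗U (x ⊕ a))))))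

translate-swap : ∀ {n} {A U : Sub n} {a} → (∀ x → A x ≡ translate U a x) → ∀ x → U x ≡ translate A a x
translate-swap {U = U} {a} A≗U+a x = trans (cong U (sym (⊕-cancelʳ x a))) (sym (A≗U+a (x ⊕ a)))

module Counting {n m : ℕ} (F : V n → V m) (k : ℕ) (deg : DegreeAtMost F k) where

  inNk : Sub n → Bool
  inNk U = does (isSubspace? k U ×-dec ¬? (vanishing? F U))

  inNAk : Sub n → Bool
  inNAk A = does (isFlat? k A ×-dec ¬? (vanishing? F A))

  inNk⇔ : ∀ {U} → inNk U ≡ true ⇔ (Subspace k U × ¬ Vanishing F U)
  inNk⇔ {U} =
    (IsSubspace⇔Subspace k ×-⇔ ⇔-id _) ⇔-∘ does≡true⇔ (isSubspace? k U ×-dec ¬? (vanishing? F U))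

  inNAk⇔ : ∀ {A} → inNAk A ≡ true ⇔ (Flat k A × ¬ Vanishing F A)
  inNAk⇔ {A} = (IsFlat⇔Flat k ×-⇔ ⇔-id _) ⇔-∘ does≡true⇔ (isFlat? k A ×-dec ¬? (vanishing? F A))

  sumOver-flat : ∀ {A U a} → Subspace k U → (∀ x → A x ≡ translate U a x) → sumOver F A ≡ sumOver F U
  sumOver-flat {a = a} subspace A≗U+a = trans (sumOver-≗ F A≗U+a) (sumOver-translate F deg subspace a)

  inNk-cong : ∀ {U U′} → (∀ x → U x ≡ U′ x) → inNk U ≡ inNk U′
  inNk-cong U≗U′ = ⇔→≡ (mk⇔ (transport U≗U′) (transport (sym ∘ U≗U′)))
    where
    transport : ∀ {U U′} → (∀ x → U x ≡ U′ x) → inNk U ≡ true → inNk U′ ≡ true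
    transport U≗U′ U∈Nk =
      let subspace , nonvanishing = Equivalence.to inNk⇔ U∈Nk
      in Equivalence.from inNk⇔
           (Subspace-cong k U≗U′ subspace , nonvanishing ∘ trans (sumOver-≗ F U≗U′))

  translate∈Nk⇒∈NAk : ∀ {A U a} → inNk U ≡ true → (∀ x → A x ≡ translate U a x) → inNAk A ∧ A a ≡ true
  translate∈Nk⇒∈NAk {A} {U} {a} U∈Nk A≗U+a =
    let subspace , nonvanishing = Equivalence.to inNk⇔ U∈Nk
    in cong₂ _∧_ (Equivalence.from inNAk⇔ ((a , U , subspace , A≗U+a) ,
                                           nonvanishing ∘ trans (sym (sumOver-flat subspace A≗U+a))))
                 (trans (A≗U+a a) (trans (cong U (⊕-self a)) (Subspace.𝟘∈ subspace)))

  NAk-member⇒translate∈Nk : ∀ {A a} → inNAk A ≡ true → A a ≡ true → inNk (translate A a) ≡ true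
  NAk-member⇒translate∈Nk {A} {a} A∈NAk a∈A =
    let (a₀ , U , subspace , A≗U+a₀) , nonvanishing = Equivalence.to inNAk⇔ A∈NAk
        a⊕a₀∈U = trans (sym (A≗U+a₀ a)) a∈A
        U≗A+a : ∀ x → U x ≡ translate A a x
        U≗A+a x = sym (trans (A≗U+a₀ (x ⊕ a))
                        (trans (cong U (⊕-assoc x a a₀))
                               (translate-member (Subspace.⊕-closed subspace) a⊕a₀∈U x)))
    in Equivalence.from inNk⇔
         (Subspace-cong k U≗A+a subspace ,
          nonvanishing ∘ trans (sumOver-flat subspace A≗U+a₀) ∘ trans (sumOver-≗ F U≗A+a))

  size-NAk : ∀ {A} → inNAk A ≡ true → size A ≡ 2 ^ k
  size-NAk A∈NAk =
    let (a , U , subspace , A≗U+a) , _ = Equivalence.to inNAk⇔ A∈NAk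
    in trans (Count.∑ₗ-cong (allVecs _) (cong toℕ ∘ A≗U+a))
             (trans (size-translate U a) (Subspace.size≡2^k subspace))

  incidence : Sub n → Sub n → V n → ℕ
  incidence A U a = toℕ (inNk U ∧ does (A ≟ₛ translate U a))

  no-incidences-at : ∀ A a → inNAk A ∧ A a ≡ false → Count.∑ₗ (allSubsets n) (λ U → incidence A U a) ≡ 0
  no-incidences-at A a A∉NAk∨a∉A =
    trans (Count.∑ₗ-cong (allSubsets n) (λ U → no-incidence U (A ≟ₛ translate U a)))
          (Count.∑ₗ-0 (allSubsets n))
    where
    no-incidence : ∀ U (d : Dec (∀ x → A x ≡ translate U a x)) → toℕ (inNk U ∧ does d) ≡ 0
    no-incidence U (yes A≗U+a) with inNk U in U∈Nk
    ... | true  with () ← trans (sym (translate∈Nk⇒∈NAk U∈Nk A≗U+a)) A∉NAk∨a∉A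
    ... | false = refl
    no-incidence U (no _) = cong toℕ (BoolP.∧-zeroʳ (inNk U))

  incidences-at : ∀ A a → Count.∑ₗ (allSubsets n) (λ U → incidence A U a) ≡ toℕ (inNAk A ∧ A a)
  incidences-at A a with inNAk A in A∈NAk | A a in a∈A
  ... | true | true = trans (Count.∑ₗ-cong (allSubsets n) only-A+a) (allSubsets-unique (translate A a))
    where
    only-A+a : ∀ U → incidence A U a ≡ toℕ (does (U ≟ₛ translate A a))
    only-A+a U = trans (cong (λ b → toℕ (inNk U ∧ b))
                             (Dec.does-⇔ (mk⇔ translate-swap translate-swap)
                                         (A ≟ₛ translate U a) (U ≟ₛ translate A a)))
                       (by-cases (U ≟ₛ translate A a))
      where
      by-cases : (d : Dec (∀ x → U x ≡ translate A a x)) → toℕ (inNk U ∧ does d) ≡ toℕ (does d)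
      by-cases (yes U≗A+a) =
        cong (λ b → toℕ (b ∧ true)) (trans (inNk-cong U≗A+a) (NAk-member⇒translate∈Nk A∈NAk a∈A))
      by-cases (no  _)     = cong toℕ (BoolP.∧-zeroʳ (inNk U))
  ... | true  | false = no-incidences-at A a (cong₂ _∧_ A∈NAk a∈A)
  ... | false | _     = no-incidences-at A a (cong (_∧ A a) A∈NAk)

  incidences : ℕ
  incidences = Count.∑ₗ (allSubsets n) (λ A → Count.∑ₗ (allSubsets n) (λ U → Count.∑ n (incidence A U)))

  incidences-by-subspace : incidences ≡ 2 ^ n * numNk F k
  incidences-by-subspace = begin
    Count.∑ₗ L (λ A → Count.∑ₗ L (λ U → Count.∑ n (incidence A U)))
      ≡⟨ Count.∑ₗ-swap L L _ ⟩
    Count.∑ₗ L (λ U → Count.∑ₗ L (λ A → Count.∑ n (incidence A U)))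
      ≡⟨ Count.∑ₗ-cong L (λ U → Count.∑ₗ-swap L (allVecs n) _) ⟩
    Count.∑ₗ L (λ U → Count.∑ n (λ a → Count.∑ₗ L (λ A → incidence A U a)))
      ≡⟨ Count.∑ₗ-cong L (λ U → Count.∑ₗ-cong (allVecs n) (λ a →
           translate-incidences (inNk U) (translate U a))) ⟩
    Count.∑ₗ L (λ U → Count.∑ n (λ _ → toℕ (inNk U)))
      ≡⟨ Count.∑ₗ-cong L (λ U → ∑-const n (toℕ (inNk U))) ⟩
    Count.∑ₗ L (λ U → 2 ^ n * toℕ (inNk U))
      ≡⟨ Count.*-∑ₗ L (2 ^ n) _ ⟩
    2 ^ n * Count.∑ₗ L (λ U → toℕ (inNk U))
      ≡⟨ cong (2 ^ n *_) (length-filter _ L) ⟨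
    2 ^ n * numNk F k ∎
    where
    open ≡-Reasoning
    L = allSubsets n
    translate-incidences : ∀ b B → Count.∑ₗ L (λ A → toℕ (b ∧ does (A ≟ₛ B))) ≡ toℕ b
    translate-incidences true  B = allSubsets-unique B
    translate-incidences false B = Count.∑ₗ-0 L

  incidences-by-flat : incidences ≡ 2 ^ k * numNAk F k
  incidences-by-flat = begin
    Count.∑ₗ L (λ A → Count.∑ₗ L (λ U → Count.∑ n (incidence A U)))
      ≡⟨ Count.∑ₗ-cong L (λ A → Count.∑ₗ-swap L (allVecs n) _) ⟩
    Count.∑ₗ L (λ A → Count.∑ n (λ a → Count.∑ₗ L (λ U → incidence A U a)))
      ≡⟨ Count.∑ₗ-cong L (λ A → Count.∑ₗ-cong (allVecs n) (incidences-at A)) ⟩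
    Count.∑ₗ L (λ A → Count.∑ n (λ a → toℕ (inNAk A ∧ A a)))
      ≡⟨ Count.∑ₗ-cong L points-of ⟩
    Count.∑ₗ L (λ A → 2 ^ k * toℕ (inNAk A))
      ≡⟨ Count.*-∑ₗ L (2 ^ k) _ ⟩
    2 ^ k * Count.∑ₗ L (λ A → toℕ (inNAk A))
      ≡⟨ cong (2 ^ k *_) (length-filter _ L) ⟨
    2 ^ k * numNAk F k ∎
    where
    open ≡-Reasoning
    L = allSubsets n
    points-of : ∀ A → Count.∑ n (λ a → toℕ (inNAk A ∧ A a)) ≡ 2 ^ k * toℕ (inNAk A)
    points-of A with inNAk A in A∈NAk
    ... | true  = trans (size-NAk A∈NAk) (sym (ℕP.*-identityʳ (2 ^ k)))
    ... | false = trans (Count.∑ₗ-0 (allVecs n)) (sym (ℕP.*-zeroʳ (2 ^ k)))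

  numNAk≡2^[n∸k]*numNk : k ≤ n → numNAk F k ≡ 2 ^ (n ∸ k) * numNk F k
  numNAk≡2^[n∸k]*numNk k≤n = ℕP.*-cancelˡ-≡ _ _ (2 ^ k) {{ℕP.m^n≢0 2 k}} (begin
    2 ^ k * numNAk F k                 ≡⟨ trans (sym incidences-by-flat) incidences-by-subspace ⟩
    2 ^ n * numNk F k                  ≡⟨ cong (λ e → 2 ^ e * numNk F k) (ℕP.m+[n∸m]≡n k≤n) ⟨
    2 ^ (k + (n ∸ k)) * numNk F k      ≡⟨ cong (_* numNk F k) (ℕP.^-distribˡ-+-* 2 k (n ∸ k)) ⟩
    2 ^ k * 2 ^ (n ∸ k) * numNk F k    ≡⟨ ℕP.*-assoc (2 ^ k) _ _ ⟩
    2 ^ k * (2 ^ (n ∸ k) * numNk F k) ∎)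
    where open ≡-Reasoning

  inNk≤isSubspace : ∀ U → toℕ (inNk U) ≤ toℕ (does (isSubspace? k U))
  inNk≤isSubspace U = by-cases (isSubspace? k U)
    where
    by-cases : (d : Dec (IsSubspace k U)) → toℕ (does (d ×-dec ¬? (vanishing? F U))) ≤ toℕ (does d)
    by-cases (yes _) = toℕ≤1 (does (¬? (vanishing? F U)))
    by-cases (no  _) = z≤n

  sumFree⇒numNk≡numSubspaces : SumFree F k → numNk F k ≡ numSubspaces n k
  sumFree⇒numNk≡numSubspaces sumFree = begin
    numNk F k                                        ≡⟨ length-filter _ L ⟩
    Count.∑ₗ L (λ U → toℕ (inNk U))                  ≡⟨ Count.∑ₗ-cong L (cong toℕ ∘ every-subspace) ⟩
    Count.∑ₗ L (λ U → toℕ (does (isSubspace? k U)))  ≡⟨ length-filter (isSubspace? k) L ⟨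
    numSubspaces n k ∎
    where
    open ≡-Reasoning
    L = allSubsets n
    nonvanishing : ∀ {U} → IsSubspace k U → ¬ Vanishing F U
    nonvanishing isSubspace = sumFree _ (Equivalence.from (IsFlat⇔Flat k)
                                          (Subspace⇒Flat k (Equivalence.to (IsSubspace⇔Subspace k) isSubspace)))
    every-subspace : ∀ U → inNk U ≡ does (isSubspace? k U)
    every-subspace U = Dec.does-⇔ (mk⇔ proj₁ (λ isSubspace → isSubspace , nonvanishing isSubspace))
                                  (isSubspace? k U ×-dec ¬? (vanishing? F U)) (isSubspace? k U)

  numNk≡numSubspaces⇒sumFree : numNk F k ≡ numSubspaces n k → SumFree F k
  numNk≡numSubspaces⇒sumFree counts≡ A isFlat vanishing =
    let a , U-found = Any.satisfied isFlat
        U , U∈ , isSubspace , A≗U+a = find U-found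
        U∈Nk : inNk U ≡ true
        U∈Nk = toℕ-injective (trans (∑ₗ-mono-≤-equality L inNk≤isSubspace counts U∈)
                                    (cong toℕ (Dec.dec-true (isSubspace? k U) isSubspace)))
        subspace , nonvanishing = Equivalence.to inNk⇔ U∈Nk
    in nonvanishing (trans (sym (sumOver-flat subspace (Equivalence.to All-allVecs⇔ A≗U+a))) vanishing)
    where
    L = allSubsets n
    counts : Count.∑ₗ L (λ U → toℕ (inNk U)) ≡ Count.∑ₗ L (λ U → toℕ (does (isSubspace? k U)))
    counts = trans (sym (length-filter _ L)) (trans counts≡ (length-filter (isSubspace? k) L))

corollary2p2 : (n m k : ℕ) (F : V n → V m) → HasDegree F k →
    (numNAk F k ≡ 2 ^ (n ∸ k) * numNk F k)
    × (SumFree F k ⇔ (numNk F k ≡ numSubspaces n k))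
corollary2p2 n m k F (deg≤k , _ , u , _ , wt[u]≡k) =
  numNAk≡2^[n∸k]*numNk (subst (_≤ n) wt[u]≡k (wt≤n u)) ,
  mk⇔ sumFree⇒numNk≡numSubspaces numNk≡numSubspaces⇒sumFree
  where open Counting F k deg≤k
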